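{- In the untyped probabilistic call-by-value $\lambda$-calculus $\Lambda_\oplus$, let $\Omega=(\lambda w.ww)(\lambda w.ww)$, $I=\lambda z.z$, $L=\lambda y.(\Omega\oplus I)$, $L_0=\lambda y.\Omega$, $L_1=\lambda y.I$, $M=\lambda u.L$ and $N=\lambda u.(L_0\oplus L_1)$. Let $P$ be a term, $x,y_1,\dots,y_n$ distinct variables such that the substituted terms below are closed, and suppose $P[M/x,L/y_1,\dots,L/y_n]\Rightarrow p$. Then for every $b=b_1\cdots b_n\in\{0,1\}^n$ there is a real $p_b$ such that $P[N/x,L_{b_1}/y_1,\dots,L_{b_n}/y_n]\Rightarrow p_b$, and $\sum_{b\in\{0,1\}^n}\frac{p_b}{2^n}\geq p$.
   Context: $\Lambda_\oplus$ terms: $M::=x\mid\lambda x.M\mid MM\mid M\oplus M$; values are closed abstractions. One-step call-by-value reduction maps a closed term to a finite sequence of closed terms: $(\lambda x.M)V\to M[V/x]$ for a value $V$, $M\oplus N\to M,N$, closed under evaluation contexts $E::=[\cdot]\mid EM\mid VE$. The relation $\Rightarrow$ between closed terms and subprobability distributions on values: $M\Rightarrow\emptyset$; $V\Rightarrow\{V^1\}$; if $M\to N_1,\dots,N_k$ and $N_i\Rightarrow\mathscr{D}_i$ then $M\Rightarrow\sum_i\frac1k\mathscr{D}_i$. $M\Rightarrow p$ means there is $\mathscr{D}$ with $M\Rightarrow\mathscr{D}$ and $\sum\mathscr{D}=p$. -}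

module Defs where

open import Data.Nat using (ℕ; zero; suc)
open import Data.Fin using (Fin; zero; suc)
open import Data.Bool using (Bool; true; false)
open import Data.Vec using (Vec; []; _∷_; lookup)
open import Data.List using (List; []; _∷_; map; length; concat; _++_)
open import Data.List.Relation.Binary.Pointwise using (Pointwise)
open import Data.Product using (_×_; _,_; proj₂; ∃)
open import Data.Integer using (+_)
open import Data.Rational using (ℚ; 0ℚ; 1ℚ; _/_; _+_; _*_)
open import Relation.Binary.PropositionalEquality using (_≡_)

infixl 7 _·_
infixl 6 _⊕_
data Term (n : ℕ) : Set where
  var : Fin n → Term n
  ƛ   : Term (suc n) → Term n
  _·_ : Term n → Term n → Term n
  _⊕_ : Term n → Term n → Term n

extR : ∀ {m n} → (Fin m → Fin n) → Fin (suc m) → Fin (suc n)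
extR ρ zero    = zero
extR ρ (suc i) = suc (ρ i)

rename : ∀ {m n} → (Fin m → Fin n) → Term m → Term n
rename ρ (var i) = var (ρ i)
rename ρ (ƛ M)   = ƛ (rename (extR ρ) M)
rename ρ (M · N) = rename ρ M · rename ρ N
rename ρ (M ⊕ N) = rename ρ M ⊕ rename ρ N

extS : ∀ {m n} → (Fin m → Term n) → Fin (suc m) → Term (suc n)
extS σ zero    = var zero
extS σ (suc i) = rename suc (σ i)

subst : ∀ {m n} → (Fin m → Term n) → Term m → Term n
subst σ (var i) = σ i
subst σ (ƛ M)   = ƛ (subst (extS σ) M)
subst σ (M · N) = subst σ M · subst σ N
subst σ (M ⊕ N) = subst σ M ⊕ subst σ N

sub₁ : ∀ {n} → Term n → Fin (suc n) → Term n
sub₁ V zero    = V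
sub₁ V (suc i) = var i

_[_] : ∀ {n} → Term (suc n) → Term n → Term n
M [ V ] = subst (sub₁ V) M

Closed : Set
Closed = Term 0

data Value : Closed → Set where
  ƛ : (M : Term 1) → Value (ƛ M)

infix 4 _⟶_
data _⟶_ : Closed → List Closed → Set where
  β    : ∀ {M V} → Value V → (ƛ M) · V ⟶ (M [ V ]) ∷ []
  choice : ∀ {M N} → M ⊕ N ⟶ M ∷ N ∷ []
  appL : ∀ {M Ns} (P : Closed) → M ⟶ Ns → M · P ⟶ map (_· P) Ns
  appR : ∀ {V M Ns} → Value V → M ⟶ Ns → V · M ⟶ map (V ·_) Ns

-- finite subprobability distributions on values, as lists of weighted
-- values (a value occurring several times has the sum of its weights)
Dist : Set
Dist = List (Closed × ℚ)

mass : Dist → ℚ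
mass []             = 0ℚ
mass ((_ , q) ∷ D) = q + mass D

scale : ℚ → Dist → Dist
scale r = map (λ { (V , q) → (V , r * q) })

-- 1/k  (k is never 0 for an actual reduction step)
inv : ℕ → ℚ
inv zero    = 0ℚ
inv (suc k) = (+ 1) / suc k

avg : List Dist → Dist
avg Ds = concat (map (scale (inv (length Ds))) Ds)

infix 4 _⇒_
data _⇒_ : Closed → Dist → Set where
  ⇒∅    : ∀ {M} → M ⇒ []
  ⇒val  : ∀ {V} → Value V → V ⇒ ((V , 1ℚ) ∷ [])
  ⇒step : ∀ {M Ns Ds} → M ⟶ Ns → Pointwise _⇒_ Ns Ds → M ⇒ avg Ds

infix 4 _⇒ₚ_
_⇒ₚ_ : Closed → ℚ → Set
M ⇒ₚ p = ∃ λ D → (M ⇒ D) × (mass D ≡ p)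

Ω I L L₀ L₁ Mt Nt : Closed
Ω  = ƛ (var zero · var zero) · ƛ (var zero · var zero)
I  = ƛ (var zero)
L  = ƛ (rename (λ ()) Ω ⊕ rename (λ ()) I)
L₀ = ƛ (rename (λ ()) Ω)
L₁ = ƛ (rename (λ ()) I)
Mt = ƛ (rename (λ ()) L)
Nt = ƛ (rename (λ ()) L₀ ⊕ rename (λ ()) L₁)

Lb : Bool → Closed
Lb false = L₀
Lb true  = L₁

-- substitution [M/x, L/y₁, …, L/yₙ]  (x = var 0, yᵢ = var i)
σM : ∀ n → Fin (suc n) → Closed
σM n zero    = Mt
σM n (suc i) = L

σN : ∀ n → Vec Bool n → Fin (suc n) → Closed
σN n b zero    = Nt
σN n b (suc i) = Lb (lookup b i)

allBits : (n : ℕ) → List (Vec Bool n)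
allBits zero    = [] ∷ []
allBits (suc n) = map (false ∷_) (allBits n) ++ map (true ∷_) (allBits n)

sumℚ : List ℚ → ℚ
sumℚ []       = 0ℚ
sumℚ (q ∷ qs) = q + sumℚ qs

pow2 : ℕ → ℕ
pow2 zero    = 1
pow2 (suc n) = 2 Data.Nat.* pow2 n

inv2^ : ℕ → ℚ
inv2^ n = inv (pow2 n)

module Submission where

-- The theorem is proved by simulating a reduction of P[M/x, L/ȳ] by the
-- reductions of the terms P[N/x, L_b/ȳ], b ∈ {0,1}ⁿ.  Both substitutions
-- replace variables by closed values, so a step of a substituted term either
-- fires a redex already present in P (and the same step exists for every
-- substitution of values), or it is a call σ(v)·W of a substituted variable v:
--   * x·W : M·W → L, while N·W → L₀ ⊕ L₁ → L₀, L₁.  The new copy of L acts as a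
--     fresh variable y₀ whose bit is averaged over, so n grows by one.
--   * yᵢ·W : L·W → Ω ⊕ I, whose Ω branch has mass 0, while L_{bᵢ}·W → Ω or I
--     according to bᵢ; the I branch is matched by the half of the b with bᵢ = 1.
-- Since L may be called repeatedly while bᵢ is fixed, the invariant remembers
-- the set c of bits already committed to 1: by induction on the derivation of
-- P[σM] ⇒ D (`simulate`) there are pb with P[σN b] ⇒ pb b and
-- mass D ≤ 𝔼_b pb (c ∨ b), where 𝔼 is the uniform average over {0,1}ⁿ.
-- Taking c = 0 and writing 𝔼 as a sum over allBits gives the theorem.

open import Defs
open import Data.Nat as ℕ using (ℕ; zero; suc)
open import Data.Fin using (Fin; zero; suc; punchIn)
open import Data.Bool using (Bool; true; false; _∨_)
open import Data.Bool.Properties using (∨-zeroʳ)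
open import Data.Vec using (Vec; []; _∷_; lookup; zipWith; replicate; _[_]≔_)
import Data.Vec.Properties as Vecₚ
open import Data.List using (List; []; _∷_; map; _++_; concat; length)
open import Data.List.Properties using (map-id; map-∘; map-++)
open import Data.List.Relation.Binary.Pointwise using (Pointwise; []; _∷_)
open import Data.Product using (Σ; _×_; _,_; ∃)
open import Data.Empty using (⊥-elim)
open import Relation.Nullary using (¬_)
open import Function using (_∘_)
open import Data.Integer using (+_)
open import Data.Rational using (ℚ; 0ℚ; 1ℚ; ½; _+_; _*_; _≤_; toℚᵘ; nonNegative)
open import Data.Rational.Properties
import Data.Rational.Unnormalised as ℚᵘ
import Data.Rational.Unnormalised.Properties as ℚᵘ
open import Data.Rational.Solver using (module +-*-Solver)
open import Relation.Binary.PropositionalEquality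
  using (_≡_; refl; sym; trans; cong; cong₂; subst₂; module ≡-Reasoning)
  renaming (subst to transport)

rename-cong : ∀ {m n} {ρ ρ′ : Fin m → Fin n} → (∀ i → ρ i ≡ ρ′ i) →
              ∀ T → rename ρ T ≡ rename ρ′ T
rename-cong e (var i) = cong var (e i)
rename-cong e (ƛ T)   = cong ƛ (rename-cong (λ { zero → refl ; (suc i) → cong suc (e i) }) T)
rename-cong e (T · U) = cong₂ _·_ (rename-cong e T) (rename-cong e U)
rename-cong e (T ⊕ U) = cong₂ _⊕_ (rename-cong e T) (rename-cong e U)

subst-cong : ∀ {m n} {σ σ′ : Fin m → Term n} → (∀ i → σ i ≡ σ′ i) →
             ∀ T → subst σ T ≡ subst σ′ T
subst-cong e (var i) = e i
subst-cong e (ƛ T)   = cong ƛ (subst-cong (λ { zero → refl ; (suc i) → cong (rename suc) (e i) }) T)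
subst-cong e (T · U) = cong₂ _·_ (subst-cong e T) (subst-cong e U)
subst-cong e (T ⊕ U) = cong₂ _⊕_ (subst-cong e T) (subst-cong e U)

rename-rename : ∀ {k m n} (ρ′ : Fin m → Fin n) (ρ : Fin k → Fin m) T →
                rename ρ′ (rename ρ T) ≡ rename (ρ′ ∘ ρ) T
rename-rename ρ′ ρ (var i) = refl
rename-rename ρ′ ρ (ƛ T)   = cong ƛ (trans (rename-rename (extR ρ′) (extR ρ) T)
                               (rename-cong (λ { zero → refl ; (suc i) → refl }) T))
rename-rename ρ′ ρ (T · U) = cong₂ _·_ (rename-rename ρ′ ρ T) (rename-rename ρ′ ρ U)
rename-rename ρ′ ρ (T ⊕ U) = cong₂ _⊕_ (rename-rename ρ′ ρ T) (rename-rename ρ′ ρ U)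

subst-rename : ∀ {k m n} (σ : Fin m → Term n) (ρ : Fin k → Fin m) T →
               subst σ (rename ρ T) ≡ subst (σ ∘ ρ) T
subst-rename σ ρ (var i) = refl
subst-rename σ ρ (ƛ T)   = cong ƛ (trans (subst-rename (extS σ) (extR ρ) T)
                             (subst-cong (λ { zero → refl ; (suc i) → refl }) T))
subst-rename σ ρ (T · U) = cong₂ _·_ (subst-rename σ ρ T) (subst-rename σ ρ U)
subst-rename σ ρ (T ⊕ U) = cong₂ _⊕_ (subst-rename σ ρ T) (subst-rename σ ρ U)

rename-subst : ∀ {k m n} (ρ : Fin m → Fin n) (σ : Fin k → Term m) T →
               rename ρ (subst σ T) ≡ subst (rename ρ ∘ σ) T
rename-subst ρ σ (var i) = refl
rename-subst ρ σ (ƛ T)   = cong ƛ (trans (rename-subst (extR ρ) (extS σ) T) (subst-cong extS-commute T))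
  where
  extS-commute : ∀ i → rename (extR ρ) (extS σ i) ≡ extS (rename ρ ∘ σ) i
  extS-commute zero    = refl
  extS-commute (suc i) = trans (rename-rename (extR ρ) suc (σ i)) (sym (rename-rename suc ρ (σ i)))
rename-subst ρ σ (T · U) = cong₂ _·_ (rename-subst ρ σ T) (rename-subst ρ σ U)
rename-subst ρ σ (T ⊕ U) = cong₂ _⊕_ (rename-subst ρ σ T) (rename-subst ρ σ U)

subst-subst : ∀ {k m n} (τ : Fin m → Term n) (σ : Fin k → Term m) T →
              subst τ (subst σ T) ≡ subst (subst τ ∘ σ) T
subst-subst τ σ (var i) = refl
subst-subst τ σ (ƛ T)   = cong ƛ (trans (subst-subst (extS τ) (extS σ) T) (subst-cong extS-commute T))
  where
  extS-commute : ∀ i → subst (extS τ) (extS σ i) ≡ extS (subst τ ∘ σ) i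
  extS-commute zero    = refl
  extS-commute (suc i) = trans (subst-rename (extS τ) suc (σ i)) (sym (rename-subst suc τ (σ i)))
subst-subst τ σ (T · U) = cong₂ _·_ (subst-subst τ σ T) (subst-subst τ σ U)
subst-subst τ σ (T ⊕ U) = cong₂ _⊕_ (subst-subst τ σ T) (subst-subst τ σ U)

subst-var : ∀ {n} (T : Term n) → subst var T ≡ T
subst-var (var i) = refl
subst-var (ƛ T)   = cong ƛ (trans (subst-cong (λ { zero → refl ; (suc i) → refl }) T) (subst-var T))
subst-var (T · U) = cong₂ _·_ (subst-var T) (subst-var U)
subst-var (T ⊕ U) = cong₂ _⊕_ (subst-var T) (subst-var U)

subst-[] : ∀ {m n} (σ : Fin m → Term n) (A : Term (suc m)) W →
           subst σ (A [ W ]) ≡ subst (extS σ) A [ subst σ W ]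
subst-[] σ A W = begin
  subst σ (A [ W ])                       ≡⟨ subst-subst σ (sub₁ W) A ⟩
  subst (subst σ ∘ sub₁ W) A              ≡⟨ subst-cong agree A ⟩
  subst (subst (sub₁ (subst σ W)) ∘ extS σ) A ≡⟨ sym (subst-subst (sub₁ (subst σ W)) (extS σ) A) ⟩
  subst (extS σ) A [ subst σ W ]          ∎
  where
  open ≡-Reasoning
  agree : ∀ i → subst σ (sub₁ W i) ≡ subst (sub₁ (subst σ W)) (extS σ i)
  agree zero    = refl
  agree (suc i) = sym (trans (subst-rename (sub₁ (subst σ W)) suc (σ i)) (subst-var (σ i)))

-- Contexts E ::= [·] | E M | V E over terms with k free variables; whether V
-- is a value (so that E is an evaluation context) is the predicate IsEvalCtx.
data Ctx (k : ℕ) : Set where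
  hole : Ctx k
  ctxL : Ctx k → Term k → Ctx k
  ctxR : Term k → Ctx k → Ctx k

plug : ∀ {k} → Ctx k → Term k → Term k
plug hole       R = R
plug (ctxL E M) R = plug E R · M
plug (ctxR V E) R = V · plug E R

renameC : ∀ {m n} → (Fin m → Fin n) → Ctx m → Ctx n
renameC ρ hole       = hole
renameC ρ (ctxL E M) = ctxL (renameC ρ E) (rename ρ M)
renameC ρ (ctxR V E) = ctxR (rename ρ V) (renameC ρ E)

substC : ∀ {m n} → (Fin m → Term n) → Ctx m → Ctx n
substC σ hole       = hole
substC σ (ctxL E M) = ctxL (substC σ E) (subst σ M)
substC σ (ctxR V E) = ctxR (subst σ V) (substC σ E)

plug-subst : ∀ {m n} (σ : Fin m → Term n) E R → subst σ (plug E R) ≡ plug (substC σ E) (subst σ R)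
plug-subst σ hole       R = refl
plug-subst σ (ctxL E M) R = cong (_· subst σ M) (plug-subst σ E R)
plug-subst σ (ctxR V E) R = cong (subst σ V ·_) (plug-subst σ E R)

substC-rename : ∀ {k m n} (σ : Fin m → Term n) (ρ : Fin k → Fin m) E →
                substC σ (renameC ρ E) ≡ substC (σ ∘ ρ) E
substC-rename σ ρ hole       = refl
substC-rename σ ρ (ctxL E M) = cong₂ ctxL (substC-rename σ ρ E) (subst-rename σ ρ M)
substC-rename σ ρ (ctxR V E) = cong₂ ctxR (subst-rename σ ρ V) (substC-rename σ ρ E)

substC-cong : ∀ {m n} {σ σ′ : Fin m → Term n} → (∀ i → σ i ≡ σ′ i) → ∀ E → substC σ E ≡ substC σ′ E
substC-cong e hole       = refl
substC-cong e (ctxL E M) = cong₂ ctxL (substC-cong e E) (subst-cong e M)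
substC-cong e (ctxR V E) = cong₂ ctxR (subst-cong e V) (substC-cong e E)

-- Open terms that become values under every substitution of closed values.
data IsVal {k} : Term k → Set where
  isVar : ∀ i → IsVal (var i)
  isƛ   : ∀ M → IsVal (ƛ M)

data IsEvalCtx {k} : Ctx k → Set where
  hole : IsEvalCtx hole
  ctxL : ∀ {E} M → IsEvalCtx E → IsEvalCtx (ctxL E M)
  ctxR : ∀ {V E} → IsVal V → IsEvalCtx E → IsEvalCtx (ctxR V E)

ValueSubst : ∀ {m} → (Fin m → Closed) → Set
ValueSubst σ = ∀ i → Value (σ i)

closed-isVal : ∀ {V : Closed} → IsVal V → Value V
closed-isVal (isƛ M) = ƛ M

closed-value : ∀ {V : Closed} → Value V → IsVal V
closed-value (ƛ M) = isƛ M

value-isVal : ∀ {m} {σ : Fin m → Closed} V → Value (subst σ V) → IsVal V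
value-isVal (var i) _ = isVar i
value-isVal (ƛ M)   _ = isƛ M

isVal-subst : ∀ {m} {σ : Fin m → Closed} → ValueSubst σ → ∀ {V} → IsVal V → Value (subst σ V)
isVal-subst vσ (isVar i) = vσ i
isVal-subst vσ (isƛ M)   = ƛ _

evalCtx-subst : ∀ {m} {σ : Fin m → Closed} → ValueSubst σ → ∀ {E} → IsEvalCtx E → IsEvalCtx (substC σ E)
evalCtx-subst vσ hole           = hole
evalCtx-subst vσ (ctxL M isE)   = ctxL _ (evalCtx-subst vσ isE)
evalCtx-subst vσ (ctxR isV isE) = ctxR (closed-value (isVal-subst vσ isV)) (evalCtx-subst vσ isE)

plug-nonvalue : ∀ (E : Ctx 0) {R} → ¬ Value R → ¬ Value (plug E R)
plug-nonvalue hole       ¬v v  = ¬v v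
plug-nonvalue (ctxL E M) ¬v ()
plug-nonvalue (ctxR V E) ¬v ()

lift : ∀ {E : Ctx 0} {R Ns} → IsEvalCtx E → R ⟶ Ns → plug E R ⟶ map (plug E) Ns
lift hole           s = transport (_ ⟶_) (sym (map-id _)) s
lift (ctxL M isE)   s = transport (_ ⟶_) (sym (map-∘ _)) (appL M (lift isE s))
lift (ctxR isV isE) s = transport (_ ⟶_) (sym (map-∘ _)) (appR (closed-isVal isV) (lift isE s))

value-irreducible : ∀ {V Ns} → Value V → ¬ (V ⟶ Ns)
value-irreducible (ƛ M) ()

det : ∀ {M Ns Ns′} → M ⟶ Ns → M ⟶ Ns′ → Ns ≡ Ns′
det (β v)      (β v′)      = refl
det (β v)      (appR v′ s) = ⊥-elim (value-irreducible v s)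
det choice     choice      = refl
det (appL P s) (appL .P s′) = cong (map _) (det s s′)
det (appL P s) (appR v s′) = ⊥-elim (value-irreducible v s)
det (appR v s) (β v′)      = ⊥-elim (value-irreducible v′ s)
det (appR v s) (appL _ s′) = ⊥-elim (value-irreducible v s′)
det (appR v s) (appR v′ s′) = cong (map _) (det s s′)

data AppStep (F X : Closed) (Ns : List Closed) : Set where
  inFun : ∀ {Ns′} → F ⟶ Ns′ → Ns ≡ map (_· X) Ns′ → AppStep F X Ns
  inArg : ∀ {Ns′} → Value F → X ⟶ Ns′ → Ns ≡ map (F ·_) Ns′ → AppStep F X Ns
  call  : Value F → Value X → AppStep F X Ns

app-step : ∀ {F X Ns} → F · X ⟶ Ns → AppStep F X Ns
app-step (β v)      = call (ƛ _) v
app-step (appL _ s) = inFun s refl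
app-step (appR v s) = inArg v s refl

-- A step of Qσ, for a substitution σ of closed values, either contracts a
-- redex of Q (and then the reducts are again σ-instances), or is a call
-- σ(i)·(Wσ) of a substituted variable in evaluation position.
data Decomposition {m} (σ : Fin m → Closed) (Q : Term m) (Ns : List Closed) : Set where
  redexβ  : ∀ E A W → IsEvalCtx E → IsVal W → Q ≡ plug E (ƛ A · W) →
            Ns ≡ subst σ (plug E (A [ W ])) ∷ [] → Decomposition σ Q Ns
  redex⊕  : ∀ E A B → IsEvalCtx E → Q ≡ plug E (A ⊕ B) →
            Ns ≡ subst σ (plug E A) ∷ subst σ (plug E B) ∷ [] → Decomposition σ Q Ns
  callVar : ∀ E i W {Ns′} → IsEvalCtx E → IsVal W → Q ≡ plug E (var i · W) →
            σ i · subst σ W ⟶ Ns′ → Ns ≡ map (plug (substC σ E)) Ns′ → Decomposition σ Q Ns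

module _ {m} {σ : Fin m → Closed} where

  decomposition-fun : ∀ {F Ns} X → Decomposition σ F Ns → Decomposition σ (F · X) (map (_· subst σ X) Ns)
  decomposition-fun X (redexβ E A W isE isW refl refl) = redexβ (ctxL E X) A W (ctxL X isE) isW refl refl
  decomposition-fun X (redex⊕ E A B isE refl refl)     = redex⊕ (ctxL E X) A B (ctxL X isE) refl refl
  decomposition-fun X (callVar E i W isE isW refl s refl) =
    callVar (ctxL E X) i W (ctxL X isE) isW refl s (sym (map-∘ _))

  decomposition-arg : ∀ {F X Ns} → IsVal F → Decomposition σ X Ns → Decomposition σ (F · X) (map (subst σ F ·_) Ns)
  decomposition-arg isF (redexβ E A W isE isW refl refl) = redexβ (ctxR _ E) A W (ctxR isF isE) isW refl refl
  decomposition-arg isF (redex⊕ E A B isE refl refl)     = redex⊕ (ctxR _ E) A B (ctxR isF isE) refl refl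
  decomposition-arg isF (callVar E i W isE isW refl s refl) =
    callVar (ctxR _ E) i W (ctxR isF isE) isW refl s (sym (map-∘ _))

  module _ (vσ : ValueSubst σ) where

    decompose-root : ∀ F X {Ns} → Value (subst σ F) → IsVal X → subst σ (F · X) ⟶ Ns →
                     Decomposition σ (F · X) Ns
    decompose-root (var i) X _ isX s = callVar hole i X hole isX refl s (sym (map-id _))
    decompose-root (ƛ A)   X _ isX s =
      redexβ hole A X hole isX refl (trans (det s (β (isVal-subst vσ isX))) (cong (_∷ []) (sym (subst-[] σ A X))))

    decompose : ∀ Q {Ns} → subst σ Q ⟶ Ns → Decomposition σ Q Ns
    decompose (var i) s = ⊥-elim (value-irreducible (vσ i) s)
    decompose (ƛ A) ()
    decompose (A ⊕ B) choice = redex⊕ hole A B hole refl refl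
    decompose (F · X) s with app-step s
    ... | inFun sF refl    = decomposition-fun X (decompose F sF)
    ... | inArg vF sX refl = decomposition-arg (value-isVal F vF) (decompose X sX)
    ... | call vF vX       = decompose-root F X vF (value-isVal X vX) s

    step-β : ∀ {E A W} → IsEvalCtx E → IsVal W →
             subst σ (plug E (ƛ A · W)) ⟶ subst σ (plug E (A [ W ])) ∷ []
    step-β {E} {A} {W} isE isW =
      subst₂ _⟶_ (sym (plug-subst σ E (ƛ A · W)))
        (cong (_∷ []) (trans (cong (plug (substC σ E)) (sym (subst-[] σ A W))) (sym (plug-subst σ E (A [ W ])))))
        (lift (evalCtx-subst vσ isE) (β (isVal-subst vσ isW)))

    step-⊕ : ∀ {E A B} → IsEvalCtx E →
             subst σ (plug E (A ⊕ B)) ⟶ subst σ (plug E A) ∷ subst σ (plug E B) ∷ []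
    step-⊕ {E} {A} {B} isE =
      subst₂ _⟶_ (sym (plug-subst σ E (A ⊕ B)))
        (sym (cong₂ (λ U V → U ∷ V ∷ []) (plug-subst σ E A) (plug-subst σ E B)))
        (lift (evalCtx-subst vσ isE) choice)

    step-call : ∀ {E i W Ns} → IsEvalCtx E → σ i · subst σ W ⟶ Ns →
                subst σ (plug E (var i · W)) ⟶ map (plug (substC σ E)) Ns
    step-call {E} {i} {W} isE s =
      transport (_⟶ _) (sym (plug-subst σ E (var i · W))) (lift (evalCtx-subst vσ isE) s)

mass-++ : ∀ D D′ → mass (D ++ D′) ≡ mass D + mass D′
mass-++ []             D′ = sym (+-identityˡ _)
mass-++ ((V , q) ∷ D) D′ = trans (cong (_+_ q) (mass-++ D D′)) (sym (+-assoc q _ _))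

mass-scale : ∀ r D → mass (scale r D) ≡ r * mass D
mass-scale r []             = sym (*-zeroʳ r)
mass-scale r ((V , q) ∷ D) = trans (cong (_+_ (r * q)) (mass-scale r D)) (sym (*-distribˡ-+ r q _))

totalMass : List Dist → ℚ
totalMass Ds = sumℚ (map mass Ds)

mass-concat-scale : ∀ r Ds → mass (concat (map (scale r) Ds)) ≡ r * totalMass Ds
mass-concat-scale r []       = sym (*-zeroʳ r)
mass-concat-scale r (D ∷ Ds) = begin
  mass (scale r D ++ concat (map (scale r) Ds))   ≡⟨ mass-++ (scale r D) _ ⟩
  mass (scale r D) + mass (concat (map (scale r) Ds)) ≡⟨ cong₂ _+_ (mass-scale r D) (mass-concat-scale r Ds) ⟩
  r * mass D + r * totalMass Ds                  ≡⟨ sym (*-distribˡ-+ r (mass D) _) ⟩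
  r * totalMass (D ∷ Ds)                         ∎
  where open ≡-Reasoning

mass-avg₁ : ∀ D → mass (avg (D ∷ [])) ≡ mass D
mass-avg₁ D = trans (mass-concat-scale 1ℚ (D ∷ [])) (trans (*-identityˡ _) (+-identityʳ (mass D)))

mass-avg₂ : ∀ D₁ D₂ → mass (avg (D₁ ∷ D₂ ∷ [])) ≡ ½ * (mass D₁ + mass D₂)
mass-avg₂ D₁ D₂ = trans (mass-concat-scale ½ (D₁ ∷ D₂ ∷ [])) (cong (λ q → ½ * (mass D₁ + q)) (+-identityʳ (mass D₂)))

inv-nonneg : ∀ k → 0ℚ ≤ inv k
inv-nonneg zero    = ≤-refl
inv-nonneg (suc k) = nonNegative⁻¹ _ {{normalize-nonNeg 1 (suc k)}}

mutual
  ⇒-nonneg : ∀ {M D} → M ⇒ D → 0ℚ ≤ mass D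
  ⇒-nonneg ⇒∅       = ≤-refl
  ⇒-nonneg (⇒val v) = nonNegative⁻¹ _
  ⇒-nonneg (⇒step {Ds = Ds} s ps) =
    transport (0ℚ ≤_) (sym (mass-concat-scale (inv (length Ds)) Ds))
      (transport (_≤ inv (length Ds) * totalMass Ds) (*-zeroʳ (inv (length Ds)))
        (*-monoˡ-≤-nonNeg (inv (length Ds)) {{nonNegative (inv-nonneg (length Ds))}} (⇒-nonneg-all ps)))

  ⇒-nonneg-all : ∀ {Ns Ds} → Pointwise _⇒_ Ns Ds → 0ℚ ≤ totalMass Ds
  ⇒-nonneg-all []       = ≤-refl
  ⇒-nonneg-all (d ∷ ps) = +-mono-≤ (⇒-nonneg d) (⇒-nonneg-all ps)

⇒ₚ-nonneg : ∀ {M p} → M ⇒ₚ p → 0ℚ ≤ p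
⇒ₚ-nonneg (D , M⇒D , refl) = ⇒-nonneg M⇒D

⇒ₚ-zero : ∀ {M} → M ⇒ₚ 0ℚ
⇒ₚ-zero = [] , ⇒∅ , refl

⇒ₚ-step₁ : ∀ {M N q} → M ⟶ N ∷ [] → N ⇒ₚ q → M ⇒ₚ q
⇒ₚ-step₁ s (D , N⇒D , refl) = avg (D ∷ []) , ⇒step s (N⇒D ∷ []) , mass-avg₁ D

⇒ₚ-step₂ : ∀ {M N₁ N₂ q₁ q₂} → M ⟶ N₁ ∷ N₂ ∷ [] → N₁ ⇒ₚ q₁ → N₂ ⇒ₚ q₂ → M ⇒ₚ ½ * (q₁ + q₂)
⇒ₚ-step₂ s (D₁ , d₁ , refl) (D₂ , d₂ , refl) = avg (D₁ ∷ D₂ ∷ []) , ⇒step s (d₁ ∷ d₂ ∷ []) , mass-avg₂ D₁ D₂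

Ω-diverges : ∀ {E D} → IsEvalCtx E → plug E Ω ⇒ D → mass D ≡ 0ℚ
Ω-diverges isE ⇒∅ = refl
Ω-diverges {E} isE (⇒val v) = ⊥-elim (plug-nonvalue E (λ ()) v)
Ω-diverges isE (⇒step s ps) with det s (lift isE (β (ƛ _)))
... | refl with ps
... | _∷_ {y = D} d [] = trans (mass-avg₁ D) (Ω-diverges isE d)

½-double : ∀ x → ½ * (x + x) ≡ x
½-double x = trans (*-distribˡ-+ ½ x x) (trans (sym (*-distribʳ-+ x ½ ½)) (*-identityˡ x))

½-interchange : ∀ a b c d → ½ * (½ * (a + b) + ½ * (c + d)) ≡ ½ * (½ * (a + c) + ½ * (b + d))
½-interchange = solve 4 (λ a b c d →
    h :* (h :* (a :+ b) :+ h :* (c :+ d)) := h :* (h :* (a :+ c) :+ h :* (b :+ d))) refl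
  where
  open +-*-Solver
  h = con ½

½-mono : ∀ {x y} → x ≤ y → ½ * x ≤ ½ * y
½-mono = *-monoˡ-≤-nonNeg ½

𝔼 : ∀ m → (Vec Bool m → ℚ) → ℚ
𝔼 zero    g = g []
𝔼 (suc m) g = ½ * (𝔼 m (g ∘ (false ∷_)) + 𝔼 m (g ∘ (true ∷_)))

𝔼-cong : ∀ m {g h : Vec Bool m → ℚ} → (∀ b → g b ≡ h b) → 𝔼 m g ≡ 𝔼 m h
𝔼-cong zero    e = e []
𝔼-cong (suc m) e = cong₂ (λ x y → ½ * (x + y)) (𝔼-cong m (e ∘ (false ∷_))) (𝔼-cong m (e ∘ (true ∷_)))

𝔼-mono : ∀ m {g h : Vec Bool m → ℚ} → (∀ b → g b ≤ h b) → 𝔼 m g ≤ 𝔼 m h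
𝔼-mono zero    e = e []
𝔼-mono (suc m) e = ½-mono (+-mono-≤ (𝔼-mono m (e ∘ (false ∷_))) (𝔼-mono m (e ∘ (true ∷_))))

𝔼-const : ∀ m q → 𝔼 m (λ _ → q) ≡ q
𝔼-const zero    q = refl
𝔼-const (suc m) q = trans (cong (λ x → ½ * (x + x)) (𝔼-const m q)) (½-double q)

𝔼-nonneg : ∀ m (g : Vec Bool m → ℚ) → (∀ b → 0ℚ ≤ g b) → 0ℚ ≤ 𝔼 m g
𝔼-nonneg m g g≥0 = transport (_≤ 𝔼 m g) (𝔼-const m 0ℚ) (𝔼-mono m g≥0)

𝔼-½ : ∀ m (g h : Vec Bool m → ℚ) → 𝔼 m (λ b → ½ * (g b + h b)) ≡ ½ * (𝔼 m g + 𝔼 m h)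
𝔼-½ zero    g h = refl
𝔼-½ (suc m) g h = begin
  ½ * (𝔼 m (λ b → ½ * (g₀ b + h₀ b)) + 𝔼 m (λ b → ½ * (g₁ b + h₁ b)))
    ≡⟨ cong₂ (λ x y → ½ * (x + y)) (𝔼-½ m g₀ h₀) (𝔼-½ m g₁ h₁) ⟩
  ½ * (½ * (𝔼 m g₀ + 𝔼 m h₀) + ½ * (𝔼 m g₁ + 𝔼 m h₁))
    ≡⟨ ½-interchange (𝔼 m g₀) (𝔼 m h₀) (𝔼 m g₁) (𝔼 m h₁) ⟩
  ½ * (𝔼 (suc m) g + 𝔼 (suc m) h) ∎
  where
  open ≡-Reasoning
  g₀ = g ∘ (false ∷_)
  g₁ = g ∘ (true ∷_)
  h₀ = h ∘ (false ∷_)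
  h₁ = h ∘ (true ∷_)

𝔼-split : ∀ m (i : Fin m) (g : Vec Bool m → ℚ) →
          𝔼 m g ≡ ½ * (𝔼 m (λ b → g (b [ i ]≔ false)) + 𝔼 m (λ b → g (b [ i ]≔ true)))
𝔼-split (suc m) zero g =
  sym (cong₂ (λ x y → ½ * (x + y)) (½-double (𝔼 m (g ∘ (false ∷_)))) (½-double (𝔼 m (g ∘ (true ∷_)))))
𝔼-split (suc m) (suc i) g = begin
  ½ * (𝔼 m g₀ + 𝔼 m g₁)
    ≡⟨ cong₂ (λ x y → ½ * (x + y)) (𝔼-split m i g₀) (𝔼-split m i g₁) ⟩
  ½ * (½ * (fixed g₀ false + fixed g₀ true) + ½ * (fixed g₁ false + fixed g₁ true))
    ≡⟨ ½-interchange (fixed g₀ false) (fixed g₀ true) (fixed g₁ false) (fixed g₁ true) ⟩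
  ½ * (½ * (fixed g₀ false + fixed g₁ false) + ½ * (fixed g₀ true + fixed g₁ true)) ∎
  where
  open ≡-Reasoning
  g₀ = g ∘ (false ∷_)
  g₁ = g ∘ (true ∷_)
  fixed : (Vec Bool m → ℚ) → Bool → ℚ
  fixed h x = 𝔼 m (λ b → h (b [ i ]≔ x))

pow2-nonzero : ∀ n → ∃ λ k → pow2 n ≡ suc k
pow2-nonzero zero    = 0 , refl
pow2-nonzero (suc n) with pow2-nonzero n
... | k , eq rewrite eq = _ , refl

inv-double : ∀ k → inv (2 ℕ.* suc k) ≡ ½ * inv (suc k)
inv-double k = toℚᵘ-injective (begin
  toℚᵘ (inv (2 ℕ.* suc k))          ≈⟨ toℚᵘ-fromℚᵘ _ ⟩
  ℚᵘ.mkℚᵘ (+ 1) 1 ℚᵘ.* ℚᵘ.mkℚᵘ (+ 1) k ≈⟨ ℚᵘ.*-cong (toℚᵘ-fromℚᵘ ½ᵘ) (toℚᵘ-fromℚᵘ (ℚᵘ.mkℚᵘ (+ 1) k)) ⟨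
  toℚᵘ ½ ℚᵘ.* toℚᵘ (inv (suc k))     ≈⟨ toℚᵘ-homo-* ½ (inv (suc k)) ⟨
  toℚᵘ (½ * inv (suc k))             ∎)
  where
  open ℚᵘ.≃-Reasoning
  ½ᵘ = ℚᵘ.mkℚᵘ (+ 1) 1

inv2^-suc : ∀ n → inv2^ (suc n) ≡ ½ * inv2^ n
inv2^-suc n with pow2-nonzero n
... | k , eq rewrite eq = inv-double k

sumℚ-++ : ∀ xs ys → sumℚ (xs ++ ys) ≡ sumℚ xs + sumℚ ys
sumℚ-++ []       ys = sym (+-identityˡ _)
sumℚ-++ (x ∷ xs) ys = trans (cong (_+_ x) (sumℚ-++ xs ys)) (sym (+-assoc x _ _))

sumℚ-map-½ : ∀ {X : Set} (f : X → ℚ) xs → sumℚ (map (λ x → ½ * f x) xs) ≡ ½ * sumℚ (map f xs)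
sumℚ-map-½ f []       = sym (*-zeroʳ ½)
sumℚ-map-½ f (x ∷ xs) =
  trans (cong (_+_ (½ * f x)) (sumℚ-map-½ f xs)) (sym (*-distribˡ-+ ½ (f x) (sumℚ (map f xs))))

sumℚ-map-cong : ∀ {X : Set} {f g : X → ℚ} → (∀ x → f x ≡ g x) → ∀ xs → sumℚ (map f xs) ≡ sumℚ (map g xs)
sumℚ-map-cong e []       = refl
sumℚ-map-cong e (x ∷ xs) = cong₂ _+_ (e x) (sumℚ-map-cong e xs)

𝔼-sum : ∀ n (g : Vec Bool n → ℚ) → 𝔼 n g ≡ sumℚ (map (λ b → g b * inv2^ n) (allBits n))
𝔼-sum zero    g = sym (trans (+-identityʳ _) (*-identityʳ _))
𝔼-sum (suc n) g = sym (begin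
  sumℚ (map F (map (false ∷_) (allBits n) ++ map (true ∷_) (allBits n)))
    ≡⟨ cong sumℚ (map-++ F (map (false ∷_) (allBits n)) _) ⟩
  sumℚ (map F (map (false ∷_) (allBits n)) ++ map F (map (true ∷_) (allBits n)))
    ≡⟨ sumℚ-++ (map F (map (false ∷_) (allBits n))) _ ⟩
  sumℚ (map F (map (false ∷_) (allBits n))) + sumℚ (map F (map (true ∷_) (allBits n)))
    ≡⟨ cong₂ _+_ (half false) (half true) ⟩
  ½ * 𝔼 n (g ∘ (false ∷_)) + ½ * 𝔼 n (g ∘ (true ∷_))
    ≡⟨ sym (*-distribˡ-+ ½ (𝔼 n (g ∘ (false ∷_))) (𝔼 n (g ∘ (true ∷_)))) ⟩
  𝔼 (suc n) g ∎)
  where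
  open ≡-Reasoning
  F : Vec Bool (suc n) → ℚ
  F b = g b * inv2^ (suc n)
  reassoc : ∀ x → x * (½ * inv2^ n) ≡ ½ * (x * inv2^ n)
  reassoc x = trans (sym (*-assoc x ½ _)) (trans (cong (_* inv2^ n) (*-comm x ½)) (*-assoc ½ x _))
  half : ∀ x → sumℚ (map F (map (x ∷_) (allBits n))) ≡ ½ * 𝔼 n (g ∘ (x ∷_))
  half x = begin
    sumℚ (map F (map (x ∷_) (allBits n)))                    ≡⟨ cong sumℚ (sym (map-∘ (allBits n))) ⟩
    sumℚ (map (λ b → g (x ∷ b) * inv2^ (suc n)) (allBits n))
      ≡⟨ sumℚ-map-cong (λ b → trans (cong (g (x ∷ b) *_) (inv2^-suc n)) (reassoc (g (x ∷ b)))) (allBits n) ⟩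
    sumℚ (map (λ b → ½ * (g (x ∷ b) * inv2^ n)) (allBits n))
      ≡⟨ sumℚ-map-½ (λ b → g (x ∷ b) * inv2^ n) (allBits n) ⟩
    ½ * sumℚ (map (λ b → g (x ∷ b) * inv2^ n) (allBits n))
      ≡⟨ cong (½ *_) (sym (𝔼-sum n (g ∘ (x ∷_)))) ⟩
    ½ * 𝔼 n (g ∘ (x ∷_))                                     ∎

_∨ᵥ_ : ∀ {m} → Vec Bool m → Vec Bool m → Vec Bool m
_∨ᵥ_ = zipWith _∨_

∨ᵥ-update : ∀ {m} (c b : Vec Bool m) i → c ∨ᵥ (b [ i ]≔ true) ≡ (c [ i ]≔ true) ∨ᵥ b
∨ᵥ-update (x ∷ c) (y ∷ b) zero    = cong (_∷ c ∨ᵥ b) (∨-zeroʳ x)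
∨ᵥ-update (x ∷ c) (y ∷ b) (suc i) = cong ((x ∨ y) ∷_) (∨ᵥ-update c b i)

lookup-∨ᵥ-update : ∀ {m} (c b : Vec Bool m) i → lookup (c ∨ᵥ (b [ i ]≔ true)) i ≡ true
lookup-∨ᵥ-update c b i = trans (Vecₚ.lookup-zipWith _∨_ i c _)
  (trans (cong (lookup c i ∨_) (Vecₚ.lookup∘update i b true)) (∨-zeroʳ (lookup c i)))

falses-∨ᵥ : ∀ {m} (b : Vec Bool m) → replicate m false ∨ᵥ b ≡ b
falses-∨ᵥ b = trans (Vecₚ.zipWith-replicate₁ _∨_ false b) (Vecₚ.map-id b)

σM-values : ∀ m → ValueSubst (σM m)
σM-values m zero    = ƛ _
σM-values m (suc i) = ƛ _

Lb-value : ∀ x → Value (Lb x)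
Lb-value false = ƛ _
Lb-value true  = ƛ _

σN-values : ∀ m a → ValueSubst (σN m a)
σN-values m a zero    = ƛ _
σN-values m a (suc i) = Lb-value (lookup a i)

-- A fresh variable y₀ inserted right after x; its bit is the new head of b.
fresh : ∀ {m} → Fin (suc m) → Fin (suc (suc m))
fresh = punchIn (suc zero)

σM-fresh : ∀ m i → σM (suc m) (fresh i) ≡ σM m i
σM-fresh m zero    = refl
σM-fresh m (suc i) = refl

σN-fresh : ∀ m x a i → σN (suc m) (x ∷ a) (fresh i) ≡ σN m a i
σN-fresh m x a zero    = refl
σN-fresh m x a (suc i) = refl

plug-fresh : ∀ {m} (σ′ : Fin (suc (suc m)) → Closed) (σ : Fin (suc m) → Closed) →
             (∀ i → σ′ (fresh i) ≡ σ i) → ∀ E →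
             subst σ′ (plug (renameC fresh E) (var (suc zero))) ≡ plug (substC σ E) (σ′ (suc zero))
plug-fresh σ′ σ agree E = trans (plug-subst σ′ (renameC fresh E) (var (suc zero)))
  (cong (λ E′ → plug E′ (σ′ (suc zero))) (trans (substC-rename σ′ fresh E) (substC-cong agree E)))

record Sim (m : ℕ) (c : Vec Bool m) (Q : Term (suc m)) (q : ℚ) : Set where
  constructor sim
  field
    pb    : Vec Bool m → ℚ
    runs  : ∀ a → subst (σN m a) Q ⇒ₚ pb a
    bound : q ≤ 𝔼 m (λ b → pb (c ∨ᵥ b))

sim-zero : ∀ {m c Q} → Sim m c Q 0ℚ
sim-zero {m} = sim (λ _ → 0ℚ) (λ _ → ⇒ₚ-zero) (transport (0ℚ ≤_) (sym (𝔼-const m 0ℚ)) ≤-refl)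

sim-value : ∀ {m c} Q → Value (subst (σM m) Q) → Sim m c Q 1ℚ
sim-value {m} Q v = sim (λ _ → 1ℚ)
  (λ a → _ , ⇒val (isVal-subst (σN-values m a) (value-isVal Q v)) , refl)
  (transport (1ℚ ≤_) (sym (𝔼-const m 1ℚ)) ≤-refl)

sim-β : ∀ {m c E A W q} → IsEvalCtx E → IsVal W →
        Sim m c (plug E (A [ W ])) q → Sim m c (plug E (ƛ A · W)) q
sim-β {m} isE isW (sim pb runs bound) =
  sim pb (λ a → ⇒ₚ-step₁ (step-β (σN-values m a) isE isW) (runs a)) bound

sim-⊕ : ∀ {m c E A B q r} → IsEvalCtx E →
        Sim m c (plug E A) q → Sim m c (plug E B) r → Sim m c (plug E (A ⊕ B)) (½ * (q + r))
sim-⊕ {m} {c} isE (sim pb₁ runs₁ bound₁) (sim pb₂ runs₂ bound₂) =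
  sim (λ a → ½ * (pb₁ a + pb₂ a))
    (λ a → ⇒ₚ-step₂ (step-⊕ (σN-values m a) isE) (runs₁ a) (runs₂ a))
    (transport (_ ≤_) (sym (𝔼-½ m (λ b → pb₁ (c ∨ᵥ b)) (λ b → pb₂ (c ∨ᵥ b)))) (½-mono (+-mono-≤ bound₁ bound₂)))

-- Calling x: M·W → L becomes the fresh variable y₀, while N·W → L₀ ⊕ L₁
-- averages the instances over the value of its bit.
sim-callM : ∀ {m c E W q} → IsEvalCtx E → IsVal W →
            Sim (suc m) (false ∷ c) (plug (renameC fresh E) (var (suc zero))) q →
            Sim m c (plug E (var zero · W)) q
sim-callM {m} {c} {E} {W} isE isW (sim pb runs bound) =
  sim (λ a → ½ * (pb (false ∷ a) + pb (true ∷ a))) runsN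
    (transport (_ ≤_) (sym (𝔼-½ m (λ b → pb (false ∷ c ∨ᵥ b)) (λ b → pb (true ∷ c ∨ᵥ b)))) bound)
  where
  runsN : ∀ a → subst (σN m a) (plug E (var zero · W)) ⇒ₚ ½ * (pb (false ∷ a) + pb (true ∷ a))
  runsN a = ⇒ₚ-step₁ (step-call (σN-values m a) isE (β (isVal-subst (σN-values m a) isW)))
              (⇒ₚ-step₂ (lift (evalCtx-subst (σN-values m a) isE) choice) (branch false) (branch true))
    where
    branch : ∀ x → plug (substC (σN m a) E) (Lb x) ⇒ₚ pb (x ∷ a)
    branch x = transport (_⇒ₚ pb (x ∷ a)) (plug-fresh (σN (suc m) (x ∷ a)) (σN m a) (σN-fresh m x a) E) (runs (x ∷ a))

when : Bool → ℚ → ℚ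
when true  q = q
when false q = 0ℚ

call-Lb : ∀ x {E W q} → IsEvalCtx E → Value W → plug E I ⇒ₚ q → plug E (Lb x · W) ⇒ₚ when x q
call-Lb false isE w _    = ⇒ₚ-zero
call-Lb true  isE w runs = ⇒ₚ-step₁ (lift isE (β w)) runs

-- Calling yᵢ: L·W → Ω ⊕ I keeps only the I branch, with weight ½, while
-- L_{aᵢ}·W → I or Ω according to aᵢ; afterwards bit i is committed to 1.
sim-callL : ∀ {m c E i W q} → IsEvalCtx E → IsVal W →
            Sim m (c [ i ]≔ true) (plug E (ƛ (var zero))) q →
            Sim m c (plug E (var (suc i) · W)) (½ * (0ℚ + q))
sim-callL {m} {c} {E} {i} {W} {q} isE isW (sim pb runs bound) = sim pbN runsN boundN
  where
  pbN : Vec Bool m → ℚ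
  pbN a = when (lookup a i) (pb a)

  runsN : ∀ a → subst (σN m a) (plug E (var (suc i) · W)) ⇒ₚ pbN a
  runsN a = transport (_⇒ₚ pbN a) (sym (plug-subst (σN m a) E (var (suc i) · W)))
    (call-Lb (lookup a i) (evalCtx-subst (σN-values m a) isE) (isVal-subst (σN-values m a) isW)
      (transport (_⇒ₚ pb a) (plug-subst (σN m a) E (ƛ (var zero))) (runs a)))

  pbN-nonneg : ∀ a → 0ℚ ≤ pbN a
  pbN-nonneg a with lookup a i
  ... | false = ≤-refl
  ... | true  = ⇒ₚ-nonneg (runs a)

  committed : ∀ b → pbN (c ∨ᵥ (b [ i ]≔ true)) ≡ pb ((c [ i ]≔ true) ∨ᵥ b)
  committed b rewrite lookup-∨ᵥ-update c b i = cong pb (∨ᵥ-update c b i)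

  boundN : ½ * (0ℚ + q) ≤ 𝔼 m (λ b → pbN (c ∨ᵥ b))
  boundN = transport (_ ≤_) (sym (𝔼-split m i (λ b → pbN (c ∨ᵥ b))))
    (½-mono (+-mono-≤ (𝔼-nonneg m _ (λ b → pbN-nonneg (c ∨ᵥ (b [ i ]≔ false))))
                      (transport (q ≤_) (sym (𝔼-cong m committed)) bound)))

mutual
  simulate : ∀ m c Q {T D} → T ≡ subst (σM m) Q → T ⇒ D → Sim m c Q (mass D)
  simulate m c Q _    ⇒∅       = sim-zero
  simulate m c Q refl (⇒val v) = sim-value Q v
  simulate m c Q refl (⇒step s ps) with decompose (σM-values m) Q s
  simulate m c .(plug E (ƛ A · W)) refl (⇒step s (_∷_ {y = D} d []))
    | redexβ E A W isE isW refl refl =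
    transport (Sim m c _) (sym (mass-avg₁ D)) (sim-β isE isW (simulate m c (plug E (A [ W ])) refl d))
  simulate m c .(plug E (A ⊕ B)) refl (⇒step s (_∷_ {y = D₁} d₁ (_∷_ {y = D₂} d₂ [])))
    | redex⊕ E A B isE refl refl =
    transport (Sim m c _) (sym (mass-avg₂ D₁ D₂))
      (sim-⊕ isE (simulate m c (plug E A) refl d₁) (simulate m c (plug E B) refl d₂))
  simulate m c .(plug E (var zero · W)) refl (⇒step s ps)
    | callVar E zero W isE isW refl s′ refl with det s′ (β (isVal-subst (σM-values m) isW))
  ... | refl with ps
  ... | _∷_ {y = D} d [] =
    transport (Sim m c _) (sym (mass-avg₁ D))
      (sim-callM isE isW (simulate (suc m) (false ∷ c) _ (sym (plug-fresh (σM (suc m)) (σM m) (σM-fresh m) E)) d))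
  simulate m c .(plug E (var (suc i) · W)) refl (⇒step s ps)
    | callVar E (suc i) W isE isW refl s′ refl with det s′ (β (isVal-subst (σM-values m) isW))
  ... | refl with ps
  ... | _∷_ {y = D} d [] = transport (Sim m c _) (sym (mass-avg₁ D)) (simulate-L m c E i W isE isW d)

  -- After L·W → Ω ⊕ I: the Ω branch has mass 0 and the I branch is simulated.
  simulate-L : ∀ m c E i W {D} → IsEvalCtx E → IsVal W →
               plug (substC (σM m) E) (Ω ⊕ I) ⇒ D → Sim m c (plug E (var (suc i) · W)) (mass D)
  simulate-L m c E i W isE isW ⇒∅ = sim-zero
  simulate-L m c E i W isE isW (⇒val v) = ⊥-elim (plug-nonvalue (substC (σM m) E) (λ ()) v)
  simulate-L m c E i W isE isW (⇒step s ps) with det s (lift isE′ choice)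
    where isE′ = evalCtx-subst (σM-values m) isE
  ... | refl with ps
  ... | _∷_ {y = DΩ} dΩ (_∷_ {y = DI} dI []) =
    transport (Sim m c _) (sym mass≡)
      (sim-callL isE isW (simulate m (c [ i ]≔ true) (plug E (ƛ (var zero))) (sym (plug-subst (σM m) E _)) dI))
    where
    mass≡ : mass (avg (DΩ ∷ DI ∷ [])) ≡ ½ * (0ℚ + mass DI)
    mass≡ = trans (mass-avg₂ DΩ DI)
      (cong (λ z → ½ * (z + mass DI)) (Ω-diverges (evalCtx-subst (σM-values m) isE) dΩ))

mainTheorem14 : (n : ℕ) (P : Term (suc n)) (p : ℚ) →
    subst (σM n) P ⇒ₚ p →
    Σ (Vec Bool n → ℚ) λ pb →
      ((b : Vec Bool n) → subst (σN n b) P ⇒ₚ pb b) ×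
      (p ≤ sumℚ (map (λ b → pb b * inv2^ n) (allBits n)))
mainTheorem14 n P p (D , P⇒D , refl) with simulate n (replicate n false) P refl P⇒D
... | sim pb runs bound = pb , runs , (begin
  mass D                                            ≤⟨ bound ⟩
  𝔼 n (λ b → pb (replicate n false ∨ᵥ b))            ≡⟨ 𝔼-cong n (cong pb ∘ falses-∨ᵥ) ⟩
  𝔼 n pb                                            ≡⟨ 𝔼-sum n pb ⟩
  sumℚ (map (λ b → pb b * inv2^ n) (allBits n))      ∎)
  where open ≤-Reasoning
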